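{- Let $G$ be a $k$-partite $k$-uniform hypergraph with vertex set $V$ and $m_V$ hyperedges. Fix some simple vector $P$ and sample a random set of vertices $V[P]$. Then $\mathbb{E}\big[|A_{V[P]}|\big]\le 2k m_V\cdot w(P)\cdot\log(2km_V)$.
   Context: $V=V_1\sqcup\cdots\sqcup V_k$ with $|V|=n$, and every hyperedge contains exactly one vertex of each $V_i$. For $P=(p_1,\dots,p_k)\in[0,1]^k$, $w(P)=\prod_ip_i$, and $V[P]$ is the random set obtained by including each $v\in V_i$ independently with probability $p_i$. $P$ is simple if each $p_i=2^{ -j}$ for some integer $j\in\{0,\dots,\lceil\log n\rceil\}$. For $U\subseteq V$, $A_U$ is the set of vertices of $U$ that have nonzero degree in the induced subhypergraph $G[U]$. Logarithms are base 2. -}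

module Defs where

open import Data.Nat as ℕ using (ℕ; zero; suc; _^_)
open import Data.Nat.Logarithm using (⌈log₂_⌉)
open import Data.Integer as ℤ using (+_; ∣_∣)
open import Data.Rational as ℚ using (ℚ; 0ℚ; 1ℚ; ½; _+_; _*_; _-_; _/_; ↥_; ↧ₙ_)
open import Data.Fin using (Fin; zero; suc; _≟_)
open import Data.Fin.Subset using (Subset)
open import Data.Vec as Vec using (Vec; []; _∷_; lookup; toList)
open import Data.List as List using (List; []; _∷_; map; foldr; length; allFin)
open import Data.Bool using (Bool; true; false; _∧_; if_then_else_)
open import Data.Sum using (_⊎_)
open import Relation.Nullary.Decidable using (⌊_⌋)
open import Data.Bool.ListAction using (any; all)
open import Data.Nat.ListAction using (sum)

-- A k-partite k-uniform hypergraph on vertex set V = Fin n: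
--   colour : Fin n → Fin k   (v ∈ V_i  iff  colour v ≡ i)
--   edges  : list of hyperedges, each a vector (e_0,...,e_{k-1}) with e_i ∈ V_i
-- (the conditions on the edges are hypotheses of the theorem).
Edge : ℕ → ℕ → Set
Edge n k = Vec (Fin n) k

ℕ→ℚ : ℕ → ℚ
ℕ→ℚ m = + m / 1

halfPow : ℕ → ℚ
halfPow zero = 1ℚ
halfPow (suc j) = ½ * halfPow j

prodFin : (k : ℕ) → (Fin k → ℚ) → ℚ
prodFin zero f = 1ℚ
prodFin (suc k) f = f zero * prodFin k (λ i → f (suc i))

w : {k : ℕ} → (Fin k → ℚ) → ℚ
w {k} P = prodFin k P

vecP : {k : ℕ} → (Fin k → ℕ) → (Fin k → ℚ)
vecP j i = halfPow (j i)

Simple : (n k : ℕ) → (Fin k → ℕ) → Set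
Simple n k j = (i : Fin k) → j i ℕ.≤ ⌈log₂ n ⌉

allSubsets : (n : ℕ) → List (Subset n)
allSubsets zero = [] ∷ []
allSubsets (suc n) = map (true ∷_) (allSubsets n) List.++ map (false ∷_) (allSubsets n)

inEdge : {n k : ℕ} → Fin n → Edge n k → Bool
inEdge v e = any (λ x → ⌊ x ≟ v ⌋) (toList e)

edgeIn : {n k : ℕ} → Subset n → Edge n k → Bool
edgeIn U e = all (λ x → lookup U x) (toList e)

inA : {n k : ℕ} → List (Edge n k) → Subset n → Fin n → Bool
inA E U v = lookup U v ∧ any (λ e → edgeIn U e ∧ inEdge v e) E

sizeA : {n k : ℕ} → List (Edge n k) → Subset n → ℕ
sizeA {n} E U = sum (map (λ v → if inA E U v then 1 else 0) (allFin n))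

probSet : {n k : ℕ} → (Fin n → Fin k) → (Fin k → ℚ) → Subset n → ℚ
probSet {n} col P U =
  foldr _*_ 1ℚ (map (λ v → if lookup U v then P (col v) else 1ℚ - P (col v)) (allFin n))

expectedA : {n k : ℕ} → (Fin n → Fin k) → List (Edge n k) → (Fin k → ℚ) → ℚ
expectedA {n} col E P =
  foldr _+_ 0ℚ (map (λ U → probSet col P U * ℕ→ℚ (sizeA E U)) (allSubsets n))

-- "x ≤ c · log₂ N", for c > 0 and N ≥ 1 (real logarithm), written without reals:
-- either x ≤ 0 (≤ c·log₂ N since N ≥ 1), or x = a/b > 0, c = d/e and
-- x/c ≤ log₂ N  ⇔  2^{ae/(bd)} ≤ N  ⇔  2^{ae} ≤ N^{bd}.
_≤_·log₂_ : ℚ → ℚ → ℕ → Set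
x ≤ c ·log₂ N = (x ℚ.≤ 0ℚ) ⊎ (2 ^ (∣ ↥ x ∣ ℕ.* ↧ₙ c) ℕ.≤ N ^ (↧ₙ x ℕ.* ∣ ↥ c ∣))

{-# OPTIONS --safe #-}
module Submission where

-- Every vertex of A_U lies in a hyperedge of G[U], so |A_U| ≤ k·m_U with m_U the number of
-- hyperedges inside U. The k vertices of a hyperedge have distinct colours, so they enter V[P]
-- independently and the hyperedge survives with probability w(P); by linearity of expectation
-- E[m_{V[P]}] = m_V·w(P). Hence E|A_{V[P]}| ≤ k·m_V·w(P), which is at most
-- 2k·m_V·w(P)·log(2k·m_V) since 2k·m_V ≥ 2.

open import Defs
open import Algebra.Bundles using (CommutativeSemiring)
open import Data.Bool using (Bool; true; false; _∧_; _∨_; if_then_else_)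
open import Data.Bool.ListAction using (any; all)
open import Data.Fin using (Fin; zero; suc; _≟_)
open import Data.Fin.Subset using (Subset)
open import Data.List using (List; []; _∷_; length; _++_; map; foldr; allFin; tabulate)
open import Data.List.Properties using (map-∘; map-tabulate)
open import Function using (_∘_; id)
open import Data.Nat using (ℕ; zero; suc)
open import Data.Vec using (Vec; []; _∷_; lookup; toList)
open import Relation.Binary.PropositionalEquality as ≡ using (_≡_; cong)
open import Relation.Nullary.Decidable using (⌊_⌋; yes; no)

map-allFin-suc : ∀ {a} {A : Set a} {n} (f : Fin (suc n) → A) →
                 map f (allFin (suc n)) ≡ f zero ∷ map (f ∘ suc) (allFin n)
map-allFin-suc f = cong (f zero ∷_)
  (≡.trans (map-tabulate suc f) (≡.sym (map-tabulate id (f ∘ suc))))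

toList≡tabulate-lookup : ∀ {A : Set} {k} (e : Vec A k) → toList e ≡ tabulate (lookup e)
toList≡tabulate-lookup []      = ≡.refl
toList≡tabulate-lookup (x ∷ e) = cong (x ∷_) (toList≡tabulate-lookup e)

Partite : ∀ {n k} → (Fin n → Fin k) → Edge n k → Set
Partite col e = ∀ i → col (lookup e i) ≡ i

module ListSum {c ℓ} (R : CommutativeSemiring c ℓ) where
  open CommutativeSemiring R hiding (zero)
  open import Algebra.Properties.CommutativeSemigroup +-commutativeSemigroup using (interchange)
  open import Relation.Binary.Reasoning.Setoid setoid

  ∑ : {A : Set} → (A → Carrier) → List A → Carrier
  ∑ f xs = foldr _+_ 0# (map f xs)

  ∏ : {A : Set} → (A → Carrier) → List A → Carrier
  ∏ f xs = foldr _*_ 1# (map f xs)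

  [_] : Bool → Carrier
  [ b ] = if b then 1# else 0#

  [∧] : ∀ a b → [ a ∧ b ] ≈ [ a ] * [ b ]
  [∧] true  b = sym (*-identityˡ [ b ])
  [∧] false b = sym (zeroˡ [ b ])

  ∑-cong : ∀ {A : Set} {f g : A → Carrier} → (∀ x → f x ≈ g x) → ∀ xs → ∑ f xs ≈ ∑ g xs
  ∑-cong f≈g []       = refl
  ∑-cong f≈g (x ∷ xs) = +-cong (f≈g x) (∑-cong f≈g xs)

  ∑-map : ∀ {A B : Set} (f : B → Carrier) (h : A → B) xs → ∑ f (map h xs) ≡ ∑ (f ∘ h) xs
  ∑-map f h xs = cong (foldr _+_ 0#) (≡.sym (map-∘ xs))

  ∑-allFin-suc : ∀ {n} (f : Fin (suc n) → Carrier) → ∑ f (allFin (suc n)) ≡ f zero + ∑ (f ∘ suc) (allFin n)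
  ∑-allFin-suc f = cong (foldr _+_ 0#) (map-allFin-suc f)

  ∑-0 : ∀ {A : Set} (xs : List A) → ∑ (λ _ → 0#) xs ≈ 0#
  ∑-0 []       = refl
  ∑-0 (x ∷ xs) = trans (+-identityˡ _) (∑-0 xs)

  ∑-++ : ∀ {A : Set} (f : A → Carrier) xs ys → ∑ f (xs ++ ys) ≈ ∑ f xs + ∑ f ys
  ∑-++ f []       ys = sym (+-identityˡ _)
  ∑-++ f (x ∷ xs) ys = trans (+-congˡ (∑-++ f xs ys)) (sym (+-assoc (f x) _ _))

  ∑-distrib-+ : ∀ {A : Set} (f g : A → Carrier) xs → ∑ (λ x → f x + g x) xs ≈ ∑ f xs + ∑ g xs
  ∑-distrib-+ f g []       = sym (+-identityˡ 0#)
  ∑-distrib-+ f g (x ∷ xs) = trans (+-congˡ (∑-distrib-+ f g xs)) (interchange (f x) (g x) _ _)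

  *-distribˡ-∑ : ∀ {A : Set} c (f : A → Carrier) xs → c * ∑ f xs ≈ ∑ (λ x → c * f x) xs
  *-distribˡ-∑ c f []       = zeroʳ c
  *-distribˡ-∑ c f (x ∷ xs) = trans (distribˡ c (f x) _) (+-congˡ (*-distribˡ-∑ c f xs))

module Counting where
  open import Data.Nat using (_+_; _*_; _≤_; z≤n; s≤s)
  open import Data.Nat.Properties
    using (+-*-commutativeSemiring; +-mono-≤; ≤-refl; ≤-reflexive; ≤-trans; *-identityʳ; *-zeroʳ;
           module ≤-Reasoning)
  open import Data.Vec.Properties using (length-toList)
  open ListSum +-*-commutativeSemiring
  open ≡ using (refl; sym; trans)

  ∑-mono-≤ : ∀ {A : Set} {f g : A → ℕ} → (∀ x → f x ≤ g x) → ∀ xs → ∑ f xs ≤ ∑ g xs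
  ∑-mono-≤ f≤g []       = z≤n
  ∑-mono-≤ f≤g (x ∷ xs) = +-mono-≤ (f≤g x) (∑-mono-≤ f≤g xs)

  ∑-1≡length : ∀ {A : Set} (xs : List A) → ∑ (λ _ → 1) xs ≡ length xs
  ∑-1≡length []       = refl
  ∑-1≡length (x ∷ xs) = cong suc (∑-1≡length xs)

  [∨]≤[]+[] : ∀ a b → [ a ∨ b ] ≤ [ a ] + [ b ]
  [∨]≤[]+[] true  b = s≤s z≤n
  [∨]≤[]+[] false b = ≤-refl

  [∧]≤[]ʳ : ∀ a b → [ a ∧ b ] ≤ [ b ]
  [∧]≤[]ʳ true  b = ≤-refl
  [∧]≤[]ʳ false b = z≤n

  ∑[any]≤∑∑ : ∀ {A B : Set} (p : A → B → Bool) xs ys →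
              ∑ (λ x → [ any (p x) ys ]) xs ≤ ∑ (λ y → ∑ (λ x → [ p x y ]) xs) ys
  ∑[any]≤∑∑ p xs []       = ≤-reflexive (∑-0 xs)
  ∑[any]≤∑∑ p xs (y ∷ ys) = begin
    ∑ (λ x → [ p x y ∨ any (p x) ys ]) xs
      ≤⟨ ∑-mono-≤ (λ x → [∨]≤[]+[] (p x y) _) xs ⟩
    ∑ (λ x → [ p x y ] + [ any (p x) ys ]) xs
      ≡⟨ ∑-distrib-+ _ _ xs ⟩
    ∑ (λ x → [ p x y ]) xs + ∑ (λ x → [ any (p x) ys ]) xs
      ≤⟨ +-mono-≤ ≤-refl (∑[any]≤∑∑ p xs ys) ⟩
    ∑ (λ x → [ p x y ]) xs + ∑ (λ y → ∑ (λ x → [ p x y ]) xs) ys ∎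
    where open ≤-Reasoning

  -- Not definitional: ⌊_⌋ only computes on a canonical Dec, and suc x ≟ suc v is a map′.
  ⌊suc≟suc⌋ : ∀ {n} (x v : Fin n) → ⌊ suc x ≟ suc v ⌋ ≡ ⌊ x ≟ v ⌋
  ⌊suc≟suc⌋ x v with x ≟ v
  ... | yes _ = refl
  ... | no  _ = refl

  ∑[≟]≡1 : ∀ {n} (x : Fin n) → ∑ (λ v → [ ⌊ x ≟ v ⌋ ]) (allFin n) ≡ 1
  ∑[≟]≡1 {suc n} x = trans (∑-allFin-suc (λ v → [ ⌊ x ≟ v ⌋ ])) (split x)
    where
    split : ∀ y → [ ⌊ y ≟ zero ⌋ ] + ∑ (λ v → [ ⌊ y ≟ suc v ⌋ ]) (allFin n) ≡ 1
    split zero    = cong suc (∑-0 (allFin n))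
    split (suc y) = trans (∑-cong (λ v → cong [_] (⌊suc≟suc⌋ y v)) (allFin n)) (∑[≟]≡1 y)

  ∑[inEdge]≤k : ∀ {n k} (e : Edge n k) → ∑ (λ v → [ inEdge v e ]) (allFin n) ≤ k
  ∑[inEdge]≤k {n} {k} e = begin
    ∑ (λ v → [ inEdge v e ]) (allFin n)
      ≤⟨ ∑[any]≤∑∑ (λ v x → ⌊ x ≟ v ⌋) (allFin n) (toList e) ⟩
    ∑ (λ x → ∑ (λ v → [ ⌊ x ≟ v ⌋ ]) (allFin n)) (toList e)
      ≡⟨ ∑-cong ∑[≟]≡1 (toList e) ⟩
    ∑ (λ _ → 1) (toList e)
      ≡⟨ ∑-1≡length (toList e) ⟩
    length (toList e)
      ≡⟨ length-toList e ⟩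
    k ∎
    where open ≤-Reasoning

  edgeCount : ∀ {n k} → List (Edge n k) → Subset n → ℕ
  edgeCount E U = ∑ (λ e → [ edgeIn U e ]) E

  ∑[∧inEdge]≤k*[] : ∀ {n k} b (e : Edge n k) → ∑ (λ v → [ b ∧ inEdge v e ]) (allFin n) ≤ k * [ b ]
  ∑[∧inEdge]≤k*[] {n} {k} true  e = ≤-trans (∑[inEdge]≤k e) (≤-reflexive (sym (*-identityʳ k)))
  ∑[∧inEdge]≤k*[] {n} {k} false e = ≤-reflexive (trans (∑-0 (allFin n)) (sym (*-zeroʳ k)))

  sizeA≤k*edgeCount : ∀ {n k} (E : List (Edge n k)) U → sizeA E U ≤ k * edgeCount E U
  sizeA≤k*edgeCount {n} {k} E U = begin
    ∑ (λ v → [ lookup U v ∧ any (λ e → edgeIn U e ∧ inEdge v e) E ]) (allFin n)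
      ≤⟨ ∑-mono-≤ (λ v → [∧]≤[]ʳ (lookup U v) _) (allFin n) ⟩
    ∑ (λ v → [ any (λ e → edgeIn U e ∧ inEdge v e) E ]) (allFin n)
      ≤⟨ ∑[any]≤∑∑ (λ v e → edgeIn U e ∧ inEdge v e) (allFin n) E ⟩
    ∑ (λ e → ∑ (λ v → [ edgeIn U e ∧ inEdge v e ]) (allFin n)) E
      ≤⟨ ∑-mono-≤ (λ e → ∑[∧inEdge]≤k*[] (edgeIn U e) e) E ⟩
    ∑ (λ e → k * [ edgeIn U e ]) E
      ≡⟨ sym (*-distribˡ-∑ k _ E) ⟩
    k * edgeCount E U ∎
    where open ≤-Reasoning

module NatCast where
  open import Data.Nat as ℕ using ()
  open import Data.Integer as ℤ using (+_)
  open import Data.Integer.Properties using (*-identityʳ; pos-*)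
  open import Data.Nat.Coprimality using (1-coprimeTo) renaming (sym to coprime-sym)
  open import Data.Rational using (mkℚ; _+_; _*_; _≤_; *≤*; _/_)
  open import Data.Rational.Properties using (normalize-coprime)
  open ≡ using (sym; trans; cong₂; subst₂)

  ℕ→ℚ≡mkℚ : ∀ a → ℕ→ℚ a ≡ mkℚ (+ a) 0 (coprime-sym (1-coprimeTo a))
  ℕ→ℚ≡mkℚ a = normalize-coprime (coprime-sym (1-coprimeTo a))

  ℕ→ℚ-+ : ∀ a b → ℕ→ℚ (a ℕ.+ b) ≡ ℕ→ℚ a + ℕ→ℚ b
  ℕ→ℚ-+ a b = sym (trans (cong₂ _+_ (ℕ→ℚ≡mkℚ a) (ℕ→ℚ≡mkℚ b))
                         (cong (_/ 1) (cong₂ ℤ._+_ (*-identityʳ (+ a)) (*-identityʳ (+ b)))))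

  ℕ→ℚ-* : ∀ a b → ℕ→ℚ (a ℕ.* b) ≡ ℕ→ℚ a * ℕ→ℚ b
  ℕ→ℚ-* a b = sym (trans (cong₂ _*_ (ℕ→ℚ≡mkℚ a) (ℕ→ℚ≡mkℚ b)) (cong (_/ 1) (sym (pos-* a b))))

  ℕ→ℚ-mono-≤ : ∀ {a b} → a ℕ.≤ b → ℕ→ℚ a ≤ ℕ→ℚ b
  ℕ→ℚ-mono-≤ {a} {b} a≤b = subst₂ _≤_ (sym (ℕ→ℚ≡mkℚ a)) (sym (ℕ→ℚ≡mkℚ b))
    (*≤* (subst₂ ℤ._≤_ (sym (*-identityʳ (+ a))) (sym (*-identityʳ (+ b))) (ℤ.+≤+ a≤b)))

module Expectation where
  open import Data.Rational using (ℚ; 0ℚ; 1ℚ; _+_; _*_; _-_; -_; _≤_; nonNegative)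
  open import Data.Rational.Properties
    using (+-*-commutativeRing; +-mono-≤; +-monoˡ-≤; +-inverseʳ; +-identityʳ; *-identityˡ; *-zeroˡ;
           *-assoc; *-monoˡ-≤-nonNeg)
  open import Data.Rational.Solver using (module +-*-Solver)
  open import Algebra.Bundles using (CommutativeRing)
  open import Data.Product using (_×_; _,_)
  open import Data.Vec using (_[_]≔_)
  open import Data.Vec.Properties using (lookup∘update; lookup∘update′)
  open import Data.List.Properties using (map-cong-local)
  open import Data.List.Relation.Unary.All as All using (All)
  open import Data.List.Relation.Unary.AllPairs using ([]; _∷_)
  open import Data.List.Relation.Unary.Unique.Propositional using (Unique)
  open import Data.Bool.ListAction using (and)
  open ListSum (CommutativeRing.commutativeSemiring +-*-commutativeRing)
  open ≡ using (_≢_; refl; sym; trans; cong₂)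

  Probability : ℚ → Set
  Probability p = 0ℚ ≤ p × p ≤ 1ℚ

  mix : ℚ → ℚ → ℚ → ℚ
  mix p a b = p * a + (1ℚ - p) * b

  module _ where
    open +-*-Solver

    mix-idem : ∀ p a → mix p a a ≡ a
    mix-idem = solve 2 (λ p a → p :* a :+ (con 1ℚ :- p) :* a := a) refl

    mix-zeroʳ : ∀ p a → mix p a 0ℚ ≡ p * a
    mix-zeroʳ = solve 2 (λ p a → p :* a :+ (con 1ℚ :- p) :* con 0ℚ := p :* a) refl

    mix-+ : ∀ p a b c d → mix p (a + c) (b + d) ≡ mix p a b + mix p c d
    mix-+ = solve 5 (λ p a b c d → p :* (a :+ c) :+ (con 1ℚ :- p) :* (b :+ d)
                                := (p :* a :+ (con 1ℚ :- p) :* b) :+ (p :* c :+ (con 1ℚ :- p) :* d)) refl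

    mix-*ˡ : ∀ p c a b → mix p (c * a) (c * b) ≡ c * mix p a b
    mix-*ˡ = solve 4 (λ p c a b → p :* (c :* a) :+ (con 1ℚ :- p) :* (c :* b)
                               := c :* (p :* a :+ (con 1ℚ :- p) :* b)) refl

    mix-interchange : ∀ p r a b c d → mix p (mix r a b) (mix r c d) ≡ mix r (mix p a c) (mix p b d)
    mix-interchange = solve 6 (λ p r a b c d →
      p :* (r :* a :+ (con 1ℚ :- r) :* b) :+ (con 1ℚ :- p) :* (r :* c :+ (con 1ℚ :- r) :* d)
      := r :* (p :* a :+ (con 1ℚ :- p) :* c) :+ (con 1ℚ :- r) :* (p :* b :+ (con 1ℚ :- p) :* d)) refl

  mix-mono-≤ : ∀ {p a a′ b b′} → Probability p → a ≤ a′ → b ≤ b′ → mix p a b ≤ mix p a′ b′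
  mix-mono-≤ {p} (0≤p , p≤1) a≤a′ b≤b′ =
    +-mono-≤ (*-monoˡ-≤-nonNeg p {{nonNegative 0≤p}} a≤a′)
             (*-monoˡ-≤-nonNeg (1ℚ - p) {{nonNegative 0≤1-p}} b≤b′)
    where
    0≤1-p : 0ℚ ≤ 1ℚ - p
    0≤1-p = ≡.subst (_≤ 1ℚ - p) (+-inverseʳ p) (+-monoˡ-≤ (- p) p≤1)

  -- 𝔼 q f is the expectation of f U when each v lies in U independently with probability q v.
  𝔼 : ∀ {n} → (Fin n → ℚ) → (Subset n → ℚ) → ℚ
  𝔼 {zero}  q f = f []
  𝔼 {suc n} q f = mix (q zero) (𝔼 (q ∘ suc) (f ∘ (true ∷_))) (𝔼 (q ∘ suc) (f ∘ (false ∷_)))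

  𝔼-cong : ∀ {n} (q : Fin n → ℚ) {f g : Subset n → ℚ} → (∀ U → f U ≡ g U) → 𝔼 q f ≡ 𝔼 q g
  𝔼-cong {zero}  q f≗g = f≗g []
  𝔼-cong {suc n} q f≗g =
    cong₂ (mix (q zero)) (𝔼-cong (q ∘ suc) (f≗g ∘ (true ∷_))) (𝔼-cong (q ∘ suc) (f≗g ∘ (false ∷_)))

  𝔼-const : ∀ {n} (q : Fin n → ℚ) c → 𝔼 q (λ _ → c) ≡ c
  𝔼-const {zero}  q c = refl
  𝔼-const {suc n} q c =
    trans (cong₂ (mix (q zero)) (𝔼-const (q ∘ suc) c) (𝔼-const (q ∘ suc) c)) (mix-idem (q zero) c)

  𝔼-+ : ∀ {n} (q : Fin n → ℚ) f g → 𝔼 q (λ U → f U + g U) ≡ 𝔼 q f + 𝔼 q g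
  𝔼-+ {zero}  q f g = refl
  𝔼-+ {suc n} q f g =
    trans (cong₂ (mix (q zero)) (𝔼-+ (q ∘ suc) _ _) (𝔼-+ (q ∘ suc) _ _)) (mix-+ (q zero) _ _ _ _)

  𝔼-*ˡ : ∀ {n} (q : Fin n → ℚ) c f → 𝔼 q (λ U → c * f U) ≡ c * 𝔼 q f
  𝔼-*ˡ {zero}  q c f = refl
  𝔼-*ˡ {suc n} q c f =
    trans (cong₂ (mix (q zero)) (𝔼-*ˡ (q ∘ suc) c _) (𝔼-*ˡ (q ∘ suc) c _)) (mix-*ˡ (q zero) c _ _)

  𝔼-mono-≤ : ∀ {n} (q : Fin n → ℚ) {f g} → (∀ v → Probability (q v)) →
             (∀ U → f U ≤ g U) → 𝔼 q f ≤ 𝔼 q g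
  𝔼-mono-≤ {zero}  q prob f≤g = f≤g []
  𝔼-mono-≤ {suc n} q prob f≤g = mix-mono-≤ (prob zero)
    (𝔼-mono-≤ (q ∘ suc) (prob ∘ suc) (f≤g ∘ (true ∷_)))
    (𝔼-mono-≤ (q ∘ suc) (prob ∘ suc) (f≤g ∘ (false ∷_)))

  𝔼-condition : ∀ {n} (q : Fin n → ℚ) f v →
                𝔼 q f ≡ mix (q v) (𝔼 q (λ U → f (U [ v ]≔ true))) (𝔼 q (λ U → f (U [ v ]≔ false)))
  𝔼-condition {suc n} q f zero    = sym (cong₂ (mix (q zero)) (mix-idem (q zero) _) (mix-idem (q zero) _))
  𝔼-condition {suc n} q f (suc v) =
    trans (cong₂ (mix (q zero)) (𝔼-condition (q ∘ suc) _ v) (𝔼-condition (q ∘ suc) _ v))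
          (mix-interchange (q zero) (q (suc v)) _ _ _ _)

  𝔼-[∈]* : ∀ {n} (q : Fin n → ℚ) f v → (∀ U b → f (U [ v ]≔ b) ≡ f U) →
           𝔼 q (λ U → [ lookup U v ] * f U) ≡ q v * 𝔼 q f
  𝔼-[∈]* q f v f-ignores-v = begin
    𝔼 q (λ U → [ lookup U v ] * f U)
      ≡⟨ 𝔼-condition q _ v ⟩
    mix (q v) (𝔼 q (λ U → [ lookup (U [ v ]≔ true) v ] * f (U [ v ]≔ true)))
              (𝔼 q (λ U → [ lookup (U [ v ]≔ false) v ] * f (U [ v ]≔ false)))
      ≡⟨ cong₂ (mix (q v)) (𝔼-cong q v∈U) (trans (𝔼-cong q v∉U) (𝔼-const q 0ℚ)) ⟩
    mix (q v) (𝔼 q f) 0ℚ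
      ≡⟨ mix-zeroʳ (q v) (𝔼 q f) ⟩
    q v * 𝔼 q f ∎
    where
    open ≡.≡-Reasoning
    v∈U : ∀ U → [ lookup (U [ v ]≔ true) v ] * f (U [ v ]≔ true) ≡ f U
    v∈U U = trans (cong₂ (λ b x → [ b ] * x) (lookup∘update v U true) (f-ignores-v U true)) (*-identityˡ (f U))
    v∉U : ∀ U → [ lookup (U [ v ]≔ false) v ] * f (U [ v ]≔ false) ≡ 0ℚ
    v∉U U = trans (cong (λ b → [ b ] * f (U [ v ]≔ false)) (lookup∘update v U false)) (*-zeroˡ (f (U [ v ]≔ false)))

  all-lookup-update : ∀ {n} (U : Subset n) v b {L} → All (v ≢_) L → all (lookup (U [ v ]≔ b)) L ≡ all (lookup U) L
  all-lookup-update U v b v∉L = cong and (map-cong-local (All.map (λ v≢x → lookup∘update′ (v≢x ∘ sym) U b) v∉L))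

  𝔼-[⊆] : ∀ {n} (q : Fin n → ℚ) L → Unique L → 𝔼 q (λ U → [ all (lookup U) L ]) ≡ ∏ q L
  𝔼-[⊆] q []      []           = 𝔼-const q 1ℚ
  𝔼-[⊆] q (v ∷ L) (v∉L ∷ uniq) = begin
    𝔼 q (λ U → [ lookup U v ∧ all (lookup U) L ])
      ≡⟨ 𝔼-cong q (λ U → [∧] (lookup U v) _) ⟩
    𝔼 q (λ U → [ lookup U v ] * [ all (lookup U) L ])
      ≡⟨ 𝔼-[∈]* q _ v (λ U b → cong [_] (all-lookup-update U v b v∉L)) ⟩
    q v * 𝔼 q (λ U → [ all (lookup U) L ])
      ≡⟨ cong (q v *_) (𝔼-[⊆] q L uniq) ⟩
    q v * ∏ q L ∎
    where open ≡.≡-Reasoning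

  probSet-∷ : ∀ {n k} (col : Fin (suc n) → Fin k) P b (U : Subset n) →
              probSet col P (b ∷ U) ≡ (if b then P (col zero) else 1ℚ - P (col zero)) * probSet (col ∘ suc) P U
  probSet-∷ col P b U =
    cong (foldr _*_ 1ℚ) (map-allFin-suc (λ v → if lookup (b ∷ U) v then P (col v) else 1ℚ - P (col v)))

  ∑-probSet*≡𝔼 : ∀ {n k} (col : Fin n → Fin k) P (f : Subset n → ℚ) →
                 ∑ (λ U → probSet col P U * f U) (allSubsets n) ≡ 𝔼 (P ∘ col) f
  ∑-probSet*≡𝔼 {zero}  col P f = trans (+-identityʳ _) (*-identityˡ (f []))
  ∑-probSet*≡𝔼 {suc n} col P f = begin
    ∑ g (map (true ∷_) S ++ map (false ∷_) S)      ≡⟨ ∑-++ g (map (true ∷_) S) (map (false ∷_) S) ⟩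
    ∑ g (map (true ∷_) S) + ∑ g (map (false ∷_) S) ≡⟨ cong₂ _+_ (branch true) (branch false) ⟩
    𝔼 (P ∘ col) f                                   ∎
    where
    open ≡.≡-Reasoning
    S : List (Subset n)
    S = allSubsets n
    g : Subset (suc n) → ℚ
    g U = probSet col P U * f U
    branch : ∀ b → ∑ g (map (b ∷_) S)
                   ≡ (if b then P (col zero) else 1ℚ - P (col zero)) * 𝔼 (P ∘ col ∘ suc) (f ∘ (b ∷_))
    branch b = begin
      ∑ g (map (b ∷_) S)
        ≡⟨ ∑-map g (b ∷_) S ⟩
      ∑ (λ U → probSet col P (b ∷ U) * f (b ∷ U)) S
        ≡⟨ ∑-cong (λ U → trans (cong (_* f (b ∷ U)) (probSet-∷ col P b U)) (*-assoc pᵇ _ _)) S ⟩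
      ∑ (λ U → pᵇ * (probSet (col ∘ suc) P U * f (b ∷ U))) S
        ≡⟨ *-distribˡ-∑ pᵇ _ S ⟨
      pᵇ * ∑ (λ U → probSet (col ∘ suc) P U * f (b ∷ U)) S
        ≡⟨ cong (pᵇ *_) (∑-probSet*≡𝔼 (col ∘ suc) P (f ∘ (b ∷_))) ⟩
      pᵇ * 𝔼 (P ∘ col ∘ suc) (f ∘ (b ∷_)) ∎
      where
      pᵇ : ℚ
      pᵇ = if b then P (col zero) else 1ℚ - P (col zero)

module SampledHypergraph where
  import Data.Nat as ℕ
  open import Data.Rational using (ℚ; 0ℚ; 1ℚ; ½; _+_; _*_; _≤_; NonNegative; nonNegative)
  open import Data.Rational.Properties
    using (+-*-commutativeRing; *-identityˡ; *-zeroˡ; *-zeroʳ; *-assoc; *-distribʳ-+; *-monoˡ-≤-nonNeg;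
           ≤-refl; ≤-reflexive; ≤-trans; ≤ᵇ⇒≤; module ≤-Reasoning)
  open import Algebra.Bundles using (CommutativeRing)
  open import Data.Product using (_,_; proj₁)
  open import Data.List.Relation.Unary.All using (All; []; _∷_)
  open import Data.List.Relation.Unary.Unique.Propositional.Properties using (tabulate⁺)
  open ListSum (CommutativeRing.commutativeSemiring +-*-commutativeRing)
  open NatCast
  open Counting using (edgeCount; sizeA≤k*edgeCount)
  open Expectation
  open ≡ using (refl; sym; trans; cong₂)

  halfPow-probability : ∀ j → Probability (halfPow j)
  halfPow-probability zero    = ≤ᵇ⇒≤ _ , ≤-refl
  halfPow-probability (suc j) with halfPow-probability j
  ... | 0≤p , p≤1 = ≤-trans (≤ᵇ⇒≤ _) (*-monoˡ-≤-nonNeg ½ 0≤p)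
                  , ≤-trans (*-monoˡ-≤-nonNeg ½ p≤1) (≤ᵇ⇒≤ _)

  prodFin-nonNeg : ∀ {k} (f : Fin k → ℚ) → (∀ i → 0ℚ ≤ f i) → 0ℚ ≤ prodFin k f
  prodFin-nonNeg {zero}  f 0≤f = ≤ᵇ⇒≤ _
  prodFin-nonNeg {suc k} f 0≤f =
    ≤-trans (≤-reflexive (sym (*-zeroʳ (f zero))))
            (*-monoˡ-≤-nonNeg (f zero) {{nonNegative (0≤f zero)}} (prodFin-nonNeg (f ∘ suc) (0≤f ∘ suc)))

  w-nonNegative : ∀ {k} (P : Fin k → ℚ) → (∀ i → Probability (P i)) → NonNegative (w P)
  w-nonNegative P prob = nonNegative (prodFin-nonNeg P (proj₁ ∘ prob))

  prodFin-cong : ∀ {k} {f g : Fin k → ℚ} → (∀ i → f i ≡ g i) → prodFin k f ≡ prodFin k g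
  prodFin-cong {zero}  f≗g = refl
  prodFin-cong {suc k} f≗g = cong₂ _*_ (f≗g zero) (prodFin-cong (f≗g ∘ suc))

  ∏-tabulate : ∀ {A : Set} {k} (q : A → ℚ) (g : Fin k → A) → ∏ q (tabulate g) ≡ prodFin k (q ∘ g)
  ∏-tabulate {k = zero}  q g = refl
  ∏-tabulate {k = suc k} q g = cong (q (g zero) *_) (∏-tabulate q (g ∘ suc))

  𝔼-edgeIn : ∀ {n k} (col : Fin n → Fin k) P (e : Edge n k) → Partite col e →
             𝔼 (P ∘ col) (λ U → [ edgeIn U e ]) ≡ w P
  𝔼-edgeIn {k = k} col P e partite = begin
    𝔼 (P ∘ col) (λ U → [ all (lookup U) (toList e) ])
      ≡⟨ cong (λ L → 𝔼 (P ∘ col) (λ U → [ all (lookup U) L ])) (toList≡tabulate-lookup e) ⟩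
    𝔼 (P ∘ col) (λ U → [ all (lookup U) (tabulate (lookup e)) ])
      ≡⟨ 𝔼-[⊆] (P ∘ col) _ (tabulate⁺ lookup-injective) ⟩
    ∏ (P ∘ col) (tabulate (lookup e))
      ≡⟨ ∏-tabulate (P ∘ col) (lookup e) ⟩
    prodFin k (P ∘ col ∘ lookup e)
      ≡⟨ prodFin-cong (cong P ∘ partite) ⟩
    w P ∎
    where
    open ≡.≡-Reasoning
    lookup-injective : ∀ {i j} → lookup e i ≡ lookup e j → i ≡ j
    lookup-injective {i} {j} eq = trans (sym (partite i)) (trans (cong col eq) (partite j))

  ℕ→ℚ-[] : ∀ b → ℕ→ℚ (if b then 1 else 0) ≡ [ b ]
  ℕ→ℚ-[] true  = refl
  ℕ→ℚ-[] false = refl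

  𝔼-edgeCount : ∀ {n k} (col : Fin n → Fin k) P (E : List (Edge n k)) → All (Partite col) E →
                𝔼 (P ∘ col) (λ U → ℕ→ℚ (edgeCount E U)) ≡ ℕ→ℚ (length E) * w P
  𝔼-edgeCount col P []      []                     = trans (𝔼-const (P ∘ col) 0ℚ) (sym (*-zeroˡ (w P)))
  𝔼-edgeCount col P (e ∷ E) (partite ∷ partiteE) = begin
    𝔼 (P ∘ col) (λ U → ℕ→ℚ (edgeCount (e ∷ E) U))
      ≡⟨ 𝔼-cong (P ∘ col) cast-∷ ⟩
    𝔼 (P ∘ col) (λ U → [ edgeIn U e ] + ℕ→ℚ (edgeCount E U))
      ≡⟨ 𝔼-+ (P ∘ col) _ _ ⟩
    𝔼 (P ∘ col) (λ U → [ edgeIn U e ]) + 𝔼 (P ∘ col) (λ U → ℕ→ℚ (edgeCount E U))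
      ≡⟨ cong₂ _+_ (𝔼-edgeIn col P e partite) (𝔼-edgeCount col P E partiteE) ⟩
    w P + ℕ→ℚ (length E) * w P
      ≡⟨ cong (_+ ℕ→ℚ (length E) * w P) (*-identityˡ (w P)) ⟨
    1ℚ * w P + ℕ→ℚ (length E) * w P
      ≡⟨ *-distribʳ-+ (w P) 1ℚ (ℕ→ℚ (length E)) ⟨
    (1ℚ + ℕ→ℚ (length E)) * w P
      ≡⟨ cong (_* w P) (ℕ→ℚ-+ 1 (length E)) ⟨
    ℕ→ℚ (suc (length E)) * w P ∎
    where
    open ≡.≡-Reasoning
    cast-∷ : ∀ U → ℕ→ℚ (edgeCount (e ∷ E) U) ≡ [ edgeIn U e ] + ℕ→ℚ (edgeCount E U)
    cast-∷ U = trans (ℕ→ℚ-+ (if edgeIn U e then 1 else 0) (edgeCount E U))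
                     (cong (_+ ℕ→ℚ (edgeCount E U)) (ℕ→ℚ-[] (edgeIn U e)))

  expectedA≤k*m*w : ∀ {n k} (col : Fin n → Fin k) (E : List (Edge n k)) P →
                    (∀ i → Probability (P i)) → All (Partite col) E →
                    expectedA col E P ≤ ℕ→ℚ (k ℕ.* length E) * w P
  expectedA≤k*m*w {n} {k} col E P prob partite = begin
    expectedA col E P
      ≡⟨ ∑-probSet*≡𝔼 col P (λ U → ℕ→ℚ (sizeA E U)) ⟩
    𝔼 q (λ U → ℕ→ℚ (sizeA E U))
      ≤⟨ 𝔼-mono-≤ q (prob ∘ col) (λ U → ℕ→ℚ-mono-≤ (sizeA≤k*edgeCount E U)) ⟩
    𝔼 q (λ U → ℕ→ℚ (k ℕ.* edgeCount E U))
      ≡⟨ 𝔼-cong q (λ U → ℕ→ℚ-* k (edgeCount E U)) ⟩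
    𝔼 q (λ U → ℕ→ℚ k * ℕ→ℚ (edgeCount E U))
      ≡⟨ 𝔼-*ˡ q (ℕ→ℚ k) _ ⟩
    ℕ→ℚ k * 𝔼 q (λ U → ℕ→ℚ (edgeCount E U))
      ≡⟨ cong (ℕ→ℚ k *_) (𝔼-edgeCount col P E partite) ⟩
    ℕ→ℚ k * (ℕ→ℚ (length E) * w P)
      ≡⟨ *-assoc (ℕ→ℚ k) (ℕ→ℚ (length E)) (w P) ⟨
    ℕ→ℚ k * ℕ→ℚ (length E) * w P
      ≡⟨ cong (_* w P) (ℕ→ℚ-* k (length E)) ⟨
    ℕ→ℚ (k ℕ.* length E) * w P ∎
    where
    open ≤-Reasoning
    q : Fin n → ℚ
    q = P ∘ col

module Logarithm where
  open import Data.Nat as ℕ using (_^_)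
  open import Data.Nat.Properties using (*-comm; ^-monoʳ-≤; ^-monoˡ-≤; module ≤-Reasoning)
  open import Data.Integer as ℤ using (+_; -[1+_]; ∣_∣)
  open import Data.Integer.Properties using (pos-*; drop‿+≤+)
  open import Data.Rational using (mkℚ; 0ℚ; _≤_; *≤*; ↥_; ↧ₙ_; nonNegative)
  open import Data.Rational.Properties using (_≤?_; ≤-trans; ≰⇒>; <⇒≤)
  open import Data.Sum using (inj₁; inj₂)
  open ≡ using (sym; subst₂)

  cross-mul-≤ : ∀ {p q} → 0ℚ ≤ p → p ≤ q → ∣ ↥ p ∣ ℕ.* ↧ₙ q ℕ.≤ ↧ₙ p ℕ.* ∣ ↥ q ∣
  cross-mul-≤ {mkℚ (+ a) p-1 _} {mkℚ (+ b) q-1 _} _ (*≤* a↧q≤b↧p) =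
    ≡.subst (a ℕ.* suc q-1 ℕ.≤_) (*-comm b (suc p-1))
      (drop‿+≤+ (subst₂ ℤ._≤_ (sym (pos-* a (suc q-1))) (sym (pos-* b (suc p-1))) a↧q≤b↧p))
  cross-mul-≤ {mkℚ -[1+ _ ] _ _} 0≤p _ with nonNegative 0≤p
  ... | ()
  cross-mul-≤ {mkℚ (+ _) _ _} {mkℚ -[1+ _ ] _ _} 0≤p p≤q with nonNegative (≤-trans 0≤p p≤q)
  ... | ()

  ≤⇒≤·log₂ : ∀ {x c N} → 2 ℕ.≤ N → x ≤ c → x ≤ c ·log₂ N
  ≤⇒≤·log₂ {x} {c} {N} 2≤N x≤c with x ≤? 0ℚ
  ... | yes x≤0 = inj₁ x≤0
  ... | no  x≰0 = inj₂ (begin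
    2 ^ (∣ ↥ x ∣ ℕ.* ↧ₙ c) ≤⟨ ^-monoʳ-≤ 2 (cross-mul-≤ (<⇒≤ (≰⇒> x≰0)) x≤c) ⟩
    2 ^ (↧ₙ x ℕ.* ∣ ↥ c ∣) ≤⟨ ^-monoˡ-≤ (↧ₙ x ℕ.* ∣ ↥ c ∣) 2≤N ⟩
    N ^ (↧ₙ x ℕ.* ∣ ↥ c ∣) ∎)
    where open ≤-Reasoning

open import Data.Nat using (_≤_; _*_)
open import Data.Nat.Properties using (≤-refl; *-mono-≤; *-monoˡ-≤; m≤n*m)
open import Data.List.Relation.Unary.All using (All)
open import Data.List.Relation.Unary.Unique.Propositional using (Unique)
open import Data.Rational using (ℚ) renaming (_*_ to _*ℚ_)
open import Data.Rational.Properties using (≤-trans; *-monoʳ-≤-nonNeg)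
open NatCast using (ℕ→ℚ-mono-≤)
open Expectation using (Probability)
open SampledHypergraph using (halfPow-probability; w-nonNegative; expectedA≤k*m*w)
open Logarithm using (≤⇒≤·log₂)

lemma6p7 : (n k : ℕ) (col : Fin n → Fin k) (E : List (Edge n k)) →
    Unique E →
    All (λ e → (i : Fin k) → col (lookup e i) ≡ i) E →
    1 ≤ k → 1 ≤ length E →
    (j : Fin k → ℕ) → Simple n k j →
    expectedA col E (vecP j)
      ≤ ℕ→ℚ (2 * k * length E) *ℚ w (vecP j)
      ·log₂ (2 * k * length E)
lemma6p7 n k col E _ partite k≥1 m≥1 j _ =
  ≤⇒≤·log₂ 2≤2km
    (≤-trans (expectedA≤k*m*w col E P prob partite)
             (*-monoʳ-≤-nonNeg (w P) {{w-nonNegative P prob}} (ℕ→ℚ-mono-≤ km≤2km)))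
  where
  P : Fin k → ℚ
  P = vecP j
  prob : ∀ i → Probability (P i)
  prob = halfPow-probability ∘ j
  2≤2km : 2 ≤ 2 * k * length E
  2≤2km = *-mono-≤ (*-mono-≤ (≤-refl {2}) k≥1) m≥1
  km≤2km : k * length E ≤ 2 * k * length E
  km≤2km = *-monoˡ-≤ (length E) (m≤n*m k 2)
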